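{- For the generalized wheel graphs $W_{m,3}$, $\mathrm{nim}(\mathrm{DNG}(W_{m,3}))=\mathrm{pty}(m)$ and $\mathrm{nim}(\mathrm{GEN}(W_{m,3}))=1-\mathrm{pty}(m)$.
   Context: For $m\ge 2$ and $n\ge 3$, the generalized wheel graph $W_{m,n}$ is the join $\overline{K}_m+C_n$ of an edgeless graph on $m$ vertices with a cycle on $n$ vertices; here $n=3$. For a graph $G=(V,E)$, a set of vertices is geodetically convex if it contains every vertex on every shortest path between two of its vertices; the convex hull $[P]$ is the smallest convex set containing $P$, and $P$ is generating if $[P]=V$. In the achievement game $\mathrm{GEN}(G)$, two players alternately select previously-unselected vertices; the game ends as soon as the selected set generates, and the last player to move wins. In the avoidance game $\mathrm{DNG}(G)$, players alternately select previously-unselected vertices such that the selected set never generates; the player who cannot move loses. $\mathrm{nim}$ denotes the nim-number of an impartial game, and $\mathrm{pty}(m):=m\bmod 2$. -}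

module Defs where

open import Data.Nat using (ℕ; zero; suc; _≤_; _<_; NonZero)
open import Data.Nat.DivMod using (_%_)
open import Data.Fin using (Fin; toℕ; splitAt)
open import Data.Fin.Subset using (Subset; _∈_; _∉_; _⊆_; _∪_; ⁅_⁆) renaming (⊥ to ∅)
open import Data.Sum using (_⊎_; inj₁; inj₂)
open import Data.Product using (Σ; _×_; ∃)
open import Data.Unit using (⊤)
open import Data.Empty using (⊥)
open import Relation.Nullary using (¬_)
open import Relation.Binary.PropositionalEquality using (_≡_)

record Graph : Set₁ where
  field
    size : ℕ
    Adj  : Fin size → Fin size → Set

module _ (G : Graph) where
  open Graph G

  data Walk : Fin size → Fin size → Set where
    []  : ∀ {u} → Walk u u
    _∷_ : ∀ {u w v} → Adj u w → Walk w v → Walk u v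

  walkLength : ∀ {u v} → Walk u v → ℕ
  walkLength []      = 0
  walkLength (_ ∷ p) = suc (walkLength p)

  data OnWalk (x : Fin size) : ∀ {u v} → Walk u v → Set where
    here-nil  : OnWalk x {x} {x} []
    here-cons : ∀ {w v} (e : Adj x w) (p : Walk w v) → OnWalk x (e ∷ p)
    there     : ∀ {u w v} (e : Adj u w) (p : Walk w v) → OnWalk x p → OnWalk x (e ∷ p)

  Shortest : ∀ {u v} → Walk u v → Set
  Shortest {u} {v} p = ∀ (q : Walk u v) → walkLength p ≤ walkLength q

  Convex : Subset size → Set
  Convex C = ∀ u v → u ∈ C → v ∈ C → (p : Walk u v) → Shortest p →
             ∀ x → OnWalk x p → x ∈ C

  -- P generates: its convex hull (the smallest convex superset, i.e. the
  -- intersection of all convex supersets) is the whole vertex set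
  Generates : Subset size → Set
  Generates P = ∀ (C : Subset size) → Convex C → P ⊆ C → ∀ x → x ∈ C

  GenMove : Subset size → Fin size → Set
  GenMove P v = v ∉ P × ¬ Generates P

  DngMove : Subset size → Fin size → Set
  DngMove P v = v ∉ P × ¬ Generates (P ∪ ⁅ v ⁆)

  -- Nim-number (Sprague-Grundy value) as a relation, by recursion on a
  -- fuel bound for the remaining number of moves:
  -- NimAt Move f P n  means: the position P has nim-number n (mex of the
  -- nim-numbers of its options).
  NimAt : (Subset size → Fin size → Set) → ℕ → Subset size → ℕ → Set
  NimAt Move zero    P n = ⊥
  NimAt Move (suc f) P n =
      (∀ k → k < n → Σ (Fin size) λ v → Move P v × NimAt Move f (P ∪ ⁅ v ⁆) k)
    × (∀ v → Move P v → ¬ NimAt Move f (P ∪ ⁅ v ⁆) n)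

  -- every move selects a new vertex, so at most `size` moves are made from
  -- the empty selection; fuel suc size is therefore sufficient.
  nimGEN≡ : ℕ → Set
  nimGEN≡ n = NimAt GenMove (suc size) ∅ n

  nimDNG≡ : ℕ → Set
  nimDNG≡ n = NimAt DngMove (suc size) ∅ n

-- Generalized wheel graph W_{m,n} = complement(K_m) + C_n on Fin (m + n):
-- vertices 0..m-1 form the independent set, m..m+n-1 the cycle.

CycleAdj : (n : ℕ) .{{_ : NonZero n}} → Fin n → Fin n → Set
CycleAdj n i j = (toℕ j ≡ suc (toℕ i) % n) ⊎ (toℕ i ≡ suc (toℕ j) % n)

WheelAdj : (m n : ℕ) .{{_ : NonZero n}} → (Fin m ⊎ Fin n) → (Fin m ⊎ Fin n) → Set
WheelAdj m n (inj₁ _) (inj₁ _) = ⊥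
WheelAdj m n (inj₁ _) (inj₂ _) = ⊤
WheelAdj m n (inj₂ _) (inj₁ _) = ⊤
WheelAdj m n (inj₂ i) (inj₂ j) = CycleAdj n i j

W : (m n : ℕ) .{{_ : NonZero n}} → Graph
W m n = record
  { size = m Data.Nat.+ n
  ; Adj  = λ x y → WheelAdj m n (splitAt m x) (splitAt m y)
  }

pty : ℕ → ℕ
pty m = m % 2

{-# OPTIONS --safe #-}
-- Every hub of W m 3 is simplicial (its neighbours are the vertices of the triangle C₃), so a set
-- missing a hub lies in the convex set of all other vertices and does not generate. Conversely, for
-- m ≥ 2 any two hubs force every rim vertex, which lies between them on a geodesic of length 2.
-- So a selection generates exactly when it contains all hubs, and both games depend only on the
-- numbers h of free hubs and r of free rim vertices, each move lowering one of them by one.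
-- In DNG every play from (h , r) with h ≥ 1 lasts exactly h − 1 + r moves, which gives the parity
-- of m + 2 at (m , 3). In GEN the mex recursion yields (h + r) mod 2 for h ≥ 2 (and 1 + r mod 2
-- for h = 1, where the game can be ended at once), hence 1 − pty m at (m , 3).

module Submission where

open import Defs
open import Data.Nat using (ℕ; zero; suc; _+_; _∸_; _≤_; _<_; z≤n; s≤s)
open import Data.Nat.Properties using (<-cmp; ≤-trans; <⇒≱; n<1+n; m<n⇒m<1+n; 1+n≢n; suc-injective; +-suc; +-comm)
open import Data.Nat.DivMod using (_%_)
open import Data.Product using (Σ; ∃; _×_; _,_; proj₁)
open import Data.Product.Properties using (,-injective)
open import Data.Sum using (_⊎_; inj₁; inj₂)
open import Data.Empty using (⊥-elim)
open import Data.Unit using (tt)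
open import Data.Fin using (Fin; zero; suc; _↑ˡ_; _↑ʳ_; splitAt; _≟_)
open import Data.Fin.Properties using (0≢1+n; ↑ˡ-injective; ↑ʳ-injective; splitAt-↑ˡ; splitAt-↑ʳ; splitAt⁻¹-↑ˡ; splitAt⁻¹-↑ʳ)
open import Data.Fin.Subset using (Subset; _∈_; _∉_; _⊆_; _∪_; ⁅_⁆; ∁; ∣_∣) renaming (⊥ to ∅)
open import Data.Fin.Subset.Properties
  using (_∈?_; ∉⊥; x∈⁅x⁆; x∈⁅y⁆⇒x≡y; x∉⁅y⁆⇒x≢y; x∈∁p⇒x∉p; x∉p⇒x∈∁p; p⊆p∪q; x∈p∪q⁺; x∈p∪q⁻;
         ∣p∣≤n; p⊂q⇒∣p∣<∣q∣; p⊂q⇒∁p⊃∁q)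
import Data.Fin.Properties as Fin
open import Function using (_∘_; Injective)
open import Relation.Nullary using (¬_; yes; no; contradiction)
open import Relation.Binary using (tri<; tri≈; tri>)
open import Relation.Binary.PropositionalEquality using (_≡_; _≢_; refl; sym; trans; cong; cong₂; subst; ≢-sym)

n%2≢[1+n]%2 : ∀ n → n % 2 ≢ suc n % 2
n%2≢[1+n]%2 0 ()
n%2≢[1+n]%2 1 ()
n%2≢[1+n]%2 (suc (suc n)) = n%2≢[1+n]%2 n

[m+n]%2≢[m+1+n]%2 : ∀ m n → (m + n) % 2 ≢ (m + suc n) % 2
[m+n]%2≢[m+1+n]%2 m n eq = n%2≢[1+n]%2 (m + n) (trans eq (cong (_% 2) (+-suc m n)))

[1+n]%2≡1∸n%2 : ∀ n → suc n % 2 ≡ 1 ∸ n % 2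
[1+n]%2≡1∸n%2 0 = refl
[1+n]%2≡1∸n%2 1 = refl
[1+n]%2≡1∸n%2 (suc (suc n)) = [1+n]%2≡1∸n%2 n

[n+3]%2≡[1+n]%2 : ∀ n → (n + 3) % 2 ≡ suc n % 2
[n+3]%2≡[1+n]%2 n = cong (_% 2) (+-comm n 3)

k<n%2⇒n≡1+n′∧n′%2≡k : ∀ {k} n → k < n % 2 → ∃ λ n′ → n ≡ suc n′ × n′ % 2 ≡ k
k<n%2⇒n≡1+n′∧n′%2≡k 1 (s≤s z≤n) = 0 , refl , refl
k<n%2⇒n≡1+n′∧n′%2≡k (suc (suc n)) k<n%2 with k<n%2⇒n≡1+n′∧n′%2≡k n k<n%2
... | n′ , refl , n′%2≡k = suc (suc n′) , refl , n′%2≡k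

∈-∪⁅⁆-self : ∀ {n} (P : Subset n) x → x ∈ P ∪ ⁅ x ⁆
∈-∪⁅⁆-self P x = x∈p∪q⁺ (inj₂ (x∈⁅x⁆ x))

∈-∪⁅⁆⁻ : ∀ {n} {P : Subset n} {x y} → x ∈ P ∪ ⁅ y ⁆ → x ≢ y → x ∈ P
∈-∪⁅⁆⁻ {P = P} {y = y} x∈ x≢y with x∈p∪q⁻ P ⁅ y ⁆ x∈
... | inj₁ x∈P = x∈P
... | inj₂ x∈⁅y⁆ = contradiction (x∈⁅y⁆⇒x≡y y x∈⁅y⁆) x≢y

unselected : ∀ {k n} → (Fin k → Fin n) → Subset n → ℕ
unselected {zero} e P = 0
unselected {suc k} e P with e zero ∈? P
... | yes _ = unselected (e ∘ suc) P
... | no _ = suc (unselected (e ∘ suc) P)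

module _ {n : ℕ} where

  unselected-cong : ∀ {k} (e : Fin k → Fin n) {P Q} →
                    (∀ i → e i ∈ P → e i ∈ Q) → (∀ i → e i ∈ Q → e i ∈ P) →
                    unselected e P ≡ unselected e Q
  unselected-cong {zero} e P⇒Q Q⇒P = refl
  unselected-cong {suc k} e {P} {Q} P⇒Q Q⇒P with e zero ∈? P | e zero ∈? Q
  ... | yes _ | yes _ = unselected-cong (e ∘ suc) (P⇒Q ∘ suc) (Q⇒P ∘ suc)
  ... | no _  | no _  = cong suc (unselected-cong (e ∘ suc) (P⇒Q ∘ suc) (Q⇒P ∘ suc))
  ... | yes p | no ¬q = contradiction (P⇒Q zero p) ¬q
  ... | no ¬p | yes q = contradiction (Q⇒P zero q) ¬p

  unselected-∪-outside : ∀ {k} (e : Fin k → Fin n) {P v} → (∀ i → e i ≢ v) →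
                         unselected e (P ∪ ⁅ v ⁆) ≡ unselected e P
  unselected-∪-outside e e≢v =
    unselected-cong e (λ i x∈ → ∈-∪⁅⁆⁻ x∈ (e≢v i)) (λ i → p⊆p∪q _)

  unselected-∪-image : ∀ {k} (e : Fin k → Fin n) {P} → Injective _≡_ _≡_ e →
                       ∀ i → e i ∉ P → unselected e P ≡ suc (unselected e (P ∪ ⁅ e i ⁆))
  unselected-∪-image {suc k} e {P} e-inj zero e0∉P
    with e zero ∈? P | e zero ∈? P ∪ ⁅ e zero ⁆
  ... | yes e0∈P | _ = contradiction e0∈P e0∉P
  ... | no _ | no e0∉P′ = contradiction (∈-∪⁅⁆-self P (e zero)) e0∉P′
  ... | no _ | yes _ = cong suc (sym (unselected-∪-outside (e ∘ suc) (λ _ → ≢-sym 0≢1+n ∘ e-inj)))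
  unselected-∪-image {suc k} e {P} e-inj (suc i) ei∉P
    with e zero ∈? P | e zero ∈? P ∪ ⁅ e (suc i) ⁆
  ... | yes _ | yes _ = unselected-∪-image (e ∘ suc) (Fin.suc-injective ∘ e-inj) i ei∉P
  ... | no _ | no _ = cong suc (unselected-∪-image (e ∘ suc) (Fin.suc-injective ∘ e-inj) i ei∉P)
  ... | yes e0∈P | no e0∉P′ = contradiction (p⊆p∪q _ e0∈P) e0∉P′
  ... | no e0∉P | yes e0∈P′ = contradiction (∈-∪⁅⁆⁻ e0∈P′ (0≢1+n ∘ e-inj)) e0∉P

  unselected-∅ : ∀ {k} (e : Fin k → Fin n) → unselected e ∅ ≡ k
  unselected-∅ {zero} e = refl
  unselected-∅ {suc k} e with e zero ∈? ∅
  ... | yes e0∈∅ = contradiction e0∈∅ ∉⊥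
  ... | no _ = cong suc (unselected-∅ (e ∘ suc))

  unselected≡0⇒∈ : ∀ {k} (e : Fin k → Fin n) {P} → unselected e P ≡ 0 → ∀ i → e i ∈ P
  unselected≡0⇒∈ {suc k} e {P} none i with e zero ∈? P
  unselected≡0⇒∈ {suc k} e none zero    | yes e0∈P = e0∈P
  unselected≡0⇒∈ {suc k} e none (suc i) | yes _ = unselected≡0⇒∈ (e ∘ suc) none i

  unselected>0⇒∉ : ∀ {k} (e : Fin k → Fin n) {P} → 0 < unselected e P → ∃ λ i → e i ∉ P
  unselected>0⇒∉ {suc k} e {P} some with e zero ∈? P
  ... | no e0∉P = zero , e0∉P
  ... | yes _ with unselected>0⇒∉ (e ∘ suc) some
  ...   | i , ei∉P = suc i , ei∉P

module _ (G : Graph) where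
  open Graph G

  nimAt-unique : ∀ {Move f P a b} → NimAt G Move f P a → NimAt G Move f P b → a ≡ b
  nimAt-unique {f = suc f} {a = a} {b} (reachA , avoidA) (reachB , avoidB) with <-cmp a b
  ... | tri≈ _ a≡b _ = a≡b
  ... | tri< a<b _ _ = let v , mv , nimA = reachB a a<b in ⊥-elim (avoidA v mv nimA)
  ... | tri> _ _ b<a = let v , mv , nimB = reachA b b<a in ⊥-elim (avoidB v mv nimB)

  ∣∁∣-∪⁅⁆ : ∀ {P : Subset size} {v} → v ∉ P → ∣ ∁ (P ∪ ⁅ v ⁆) ∣ < ∣ ∁ P ∣
  ∣∁∣-∪⁅⁆ {P} {v} v∉P = p⊂q⇒∣p∣<∣q∣ (p⊂q⇒∁p⊃∁q (p⊆p∪q ⁅ v ⁆ , v , ∈-∪⁅⁆-self P v , v∉P))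

  nimAt-mex : (Move : Subset size → Fin size → Set) (val : Subset size → ℕ) →
              (∀ {P v} → Move P v → v ∉ P) →
              (∀ {P k} → k < val P → Σ (Fin size) λ v → Move P v × val (P ∪ ⁅ v ⁆) ≡ k) →
              (∀ {P v} → Move P v → val (P ∪ ⁅ v ⁆) ≢ val P) →
              ∀ P → NimAt G Move (suc size) P (val P)
  nimAt-mex Move val fresh reach avoid P = go (suc size) P (s≤s (∣p∣≤n (∁ P)))
    where
    go : ∀ f P → ∣ ∁ P ∣ < f → NimAt G Move f P (val P)
    go (suc f) P (s≤s bound) = reached , avoided
      where
      next : ∀ {v} → Move P v → NimAt G Move f (P ∪ ⁅ v ⁆) (val (P ∪ ⁅ v ⁆))
      next mv = go f _ (≤-trans (∣∁∣-∪⁅⁆ (fresh mv)) bound)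

      reached : ∀ k → k < val P → Σ (Fin size) λ v → Move P v × NimAt G Move f (P ∪ ⁅ v ⁆) k
      reached k k<val with reach k<val
      ... | v , mv , refl = v , mv , next mv

      avoided : ∀ v → Move P v → ¬ NimAt G Move f (P ∪ ⁅ v ⁆) (val P)
      avoided v mv nim = avoid mv (nimAt-unique (next mv) nim)

module _ (G : Graph) where
  open Graph G

  Simplicial : Fin size → Set
  Simplicial x = ∀ {u w} → Adj u x → Adj x w → u ≡ w ⊎ Adj u w

  simplicial-bypass : ∀ {x u v} → Simplicial x → Adj u x → (p : Walk G x v) → v ≢ x →
                      Σ (Walk G u v) λ q → walkLength G q < suc (walkLength G p)
  simplicial-bypass s ux [] v≢x = ⊥-elim (v≢x refl)
  simplicial-bypass s ux (xw ∷ p) v≢x with s ux xw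
  ... | inj₁ refl = p , m<n⇒m<1+n (n<1+n _)
  ... | inj₂ uw = uw ∷ p , n<1+n _

  simplicial-shortcut : ∀ {x u v} → Simplicial x → (p : Walk G u v) → OnWalk G x p →
                        u ≢ x → v ≢ x → Σ (Walk G u v) λ q → walkLength G q < walkLength G p
  simplicial-shortcut s [] here-nil u≢x _ = ⊥-elim (u≢x refl)
  simplicial-shortcut s (_ ∷ _) (here-cons _ _) u≢x _ = ⊥-elim (u≢x refl)
  simplicial-shortcut {x} s (_∷_ {w = w} uw p) (there _ _ x∈p) u≢x v≢x with w ≟ x
  ... | yes refl = simplicial-bypass s uw p v≢x
  ... | no w≢x = let q , shorter = simplicial-shortcut s p x∈p w≢x v≢x in uw ∷ q , s≤s shorter

  ∁⁅simplicial⁆-convex : ∀ {x} → Simplicial x → Convex G (∁ ⁅ x ⁆)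
  ∁⁅simplicial⁆-convex {x} s u v u∈ v∈ p shortest y y∈p = x∉p⇒x∈∁p λ y∈⁅x⁆ →
    let q , shorter = simplicial-shortcut s p (subst (λ z → OnWalk G z p) (x∈⁅y⁆⇒x≡y x y∈⁅x⁆) y∈p)
                        (x∉⁅y⁆⇒x≢y (x∈∁p⇒x∉p u∈)) (x∉⁅y⁆⇒x≢y (x∈∁p⇒x∉p v∈))
    in <⇒≱ shorter (shortest q)

  simplicial-∉⇒¬generates : ∀ {x P} → Simplicial x → x ∉ P → ¬ Generates G P
  simplicial-∉⇒¬generates {x} {P} s x∉P generates =
    x∈∁p⇒x∉p (generates (∁ ⁅ x ⁆) (∁⁅simplicial⁆-convex s) P⊆∁⁅x⁆ x) (x∈⁅x⁆ x)
    where
    P⊆∁⁅x⁆ : P ⊆ ∁ ⁅ x ⁆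
    P⊆∁⁅x⁆ y∈P = x∉p⇒x∈∁p λ y∈⁅x⁆ → x∉P (subst (_∈ P) (x∈⁅y⁆⇒x≡y x y∈⁅x⁆) y∈P)

  nonadjacent⇒2≤walkLength : ∀ {u v} → u ≢ v → ¬ Adj u v → (p : Walk G u v) → 2 ≤ walkLength G p
  nonadjacent⇒2≤walkLength u≢v _ [] = ⊥-elim (u≢v refl)
  nonadjacent⇒2≤walkLength _ ¬uv (uv ∷ []) = ⊥-elim (¬uv uv)
  nonadjacent⇒2≤walkLength _ _ (_ ∷ (_ ∷ _)) = s≤s (s≤s z≤n)

  convex-∋-common-neighbour : ∀ {C u v x} → Convex G C → u ∈ C → v ∈ C → u ≢ v → ¬ Adj u v →
                              Adj u x → Adj x v → x ∈ C
  convex-∋-common-neighbour {x = x} convex u∈ v∈ u≢v ¬uv ux xv =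
    convex _ _ u∈ v∈ (ux ∷ (xv ∷ [])) (nonadjacent⇒2≤walkLength u≢v ¬uv) x (there ux _ (here-cons xv []))

-- Positions (h , r) count the free hubs and free rim vertices of W m 3.
data Step : ℕ × ℕ → ℕ × ℕ → Set where
  hub-step : ∀ {h r} → Step (suc h , r) (h , r)
  rim-step : ∀ {h r} → Step (h , suc r) (h , r)

dngValue : ℕ × ℕ → ℕ
dngValue (zero , r) = 0
dngValue (suc h , r) = (h + r) % 2

genValue : ℕ × ℕ → ℕ
genValue (zero , r) = 0
genValue (suc zero , r) = suc (r % 2)
genValue (suc (suc h) , r) = (h + r) % 2

dngValue-reach : ∀ {s k} → k < dngValue s →
                 Σ (ℕ × ℕ) λ s′ → Step s s′ × 0 < proj₁ s′ × dngValue s′ ≡ k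
dngValue-reach {suc zero , r} k<val with k<n%2⇒n≡1+n′∧n′%2≡k r k<val
... | r′ , refl , r′%2≡k = (1 , r′) , rim-step , s≤s z≤n , r′%2≡k
dngValue-reach {suc (suc h) , r} k<val with k<n%2⇒n≡1+n′∧n′%2≡k (suc h + r) k<val
... | n′ , eq , n′%2≡k =
  (suc h , r) , hub-step , s≤s z≤n , trans (cong (_% 2) (suc-injective eq)) n′%2≡k

dngValue-avoid : ∀ {s s′} → Step s s′ → 0 < proj₁ s′ → dngValue s′ ≢ dngValue s
dngValue-avoid (hub-step {suc h} {r}) _ = n%2≢[1+n]%2 (h + r)
dngValue-avoid (rim-step {suc h} {r}) _ = [m+n]%2≢[m+1+n]%2 h r

genValue-reach : ∀ {s k} → k < genValue s →
                 Σ (ℕ × ℕ) λ s′ → Step s s′ × 0 < proj₁ s × genValue s′ ≡ k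
genValue-reach {suc zero , r} {zero} _ = (0 , r) , hub-step , s≤s z≤n , refl
genValue-reach {suc zero , r} {suc k} (s≤s k<val) with k<n%2⇒n≡1+n′∧n′%2≡k r k<val
... | r′ , refl , r′%2≡k = (1 , r′) , rim-step , s≤s z≤n , cong suc r′%2≡k
genValue-reach {suc (suc zero) , r} k<val with k<n%2⇒n≡1+n′∧n′%2≡k r k<val
... | r′ , refl , r′%2≡k = (2 , r′) , rim-step , s≤s z≤n , r′%2≡k
genValue-reach {suc (suc (suc h)) , r} k<val with k<n%2⇒n≡1+n′∧n′%2≡k (suc h + r) k<val
... | n′ , eq , n′%2≡k =
  (suc (suc h) , r) , hub-step , s≤s z≤n , trans (cong (_% 2) (suc-injective eq)) n′%2≡k

genValue-avoid : ∀ {s s′} → Step s s′ → 0 < proj₁ s → genValue s′ ≢ genValue s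
genValue-avoid (hub-step {zero}) _ ()
genValue-avoid (hub-step {suc zero}) _ = 1+n≢n
genValue-avoid (hub-step {suc (suc h)} {r}) _ = n%2≢[1+n]%2 (h + r)
genValue-avoid (rim-step {suc zero} {r}) _ = n%2≢[1+n]%2 r ∘ suc-injective
genValue-avoid (rim-step {suc (suc h)} {r}) _ = [m+n]%2≢[m+1+n]%2 h r

dngValue-initial : ∀ {m} → 1 ≤ m → dngValue (m , 3) ≡ pty m
dngValue-initial {suc h} (s≤s _) = [n+3]%2≡[1+n]%2 h

genValue-initial : ∀ {m} → 2 ≤ m → genValue (m , 3) ≡ 1 ∸ pty m
genValue-initial {suc (suc h)} (s≤s (s≤s _)) = trans ([n+3]%2≡[1+n]%2 h) ([1+n]%2≡1∸n%2 h)

C₃-adjacent : ∀ {j j′ : Fin 3} → j ≢ j′ → CycleAdj 3 j j′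
C₃-adjacent {zero}           {zero}           j≢j′ = ⊥-elim (j≢j′ refl)
C₃-adjacent {zero}           {suc zero}       _ = inj₁ refl
C₃-adjacent {zero}           {suc (suc zero)} _ = inj₂ refl
C₃-adjacent {suc zero}       {zero}           _ = inj₂ refl
C₃-adjacent {suc zero}       {suc zero}       j≢j′ = ⊥-elim (j≢j′ refl)
C₃-adjacent {suc zero}       {suc (suc zero)} _ = inj₁ refl
C₃-adjacent {suc (suc zero)} {zero}           _ = inj₁ refl
C₃-adjacent {suc (suc zero)} {suc zero}       _ = inj₂ refl
C₃-adjacent {suc (suc zero)} {suc (suc zero)} j≢j′ = ⊥-elim (j≢j′ refl)

module Wheel (m : ℕ) where
  open Graph (W m 3) using (Adj)

  Vertex : Set
  Vertex = Fin (m + 3)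

  hub : Fin m → Vertex
  hub i = i ↑ˡ 3

  rim : Fin 3 → Vertex
  rim j = m ↑ʳ j

  vertex-cases : ∀ x → (∃ λ i → hub i ≡ x) ⊎ (∃ λ j → rim j ≡ x)
  vertex-cases x with splitAt m x in eq
  ... | inj₁ i = inj₁ (i , splitAt⁻¹-↑ˡ eq)
  ... | inj₂ j = inj₂ (j , splitAt⁻¹-↑ʳ eq)

  hub-injective : Injective _≡_ _≡_ hub
  hub-injective = ↑ˡ-injective 3 _ _

  hub≢rim : ∀ {i j} → hub i ≢ rim j
  hub≢rim {i} {j} eq with trans (sym (splitAt-↑ˡ m i 3)) (trans (cong (splitAt m) eq) (splitAt-↑ʳ m 3 j))
  ... | ()

  adjacent⁺ : ∀ {x y a b} → splitAt m x ≡ a → splitAt m y ≡ b → WheelAdj m 3 a b → Adj x y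
  adjacent⁺ refl refl xy = xy

  adjacent⁻ : ∀ {x y a b} → splitAt m x ≡ a → splitAt m y ≡ b → Adj x y → WheelAdj m 3 a b
  adjacent⁻ refl refl xy = xy

  hub-rim-adjacent : ∀ i j → Adj (hub i) (rim j)
  hub-rim-adjacent i j = adjacent⁺ (splitAt-↑ˡ m i 3) (splitAt-↑ʳ m 3 j) tt

  rim-hub-adjacent : ∀ j i → Adj (rim j) (hub i)
  rim-hub-adjacent j i = adjacent⁺ (splitAt-↑ʳ m 3 j) (splitAt-↑ˡ m i 3) tt

  rim-rim-adjacent : ∀ {j j′} → j ≢ j′ → Adj (rim j) (rim j′)
  rim-rim-adjacent {j} {j′} j≢j′ = adjacent⁺ (splitAt-↑ʳ m 3 j) (splitAt-↑ʳ m 3 j′) (C₃-adjacent j≢j′)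

  hubs-nonadjacent : ∀ i i′ → ¬ Adj (hub i) (hub i′)
  hubs-nonadjacent i i′ = adjacent⁻ (splitAt-↑ˡ m i 3) (splitAt-↑ˡ m i′ 3)

  hub-neighbourʳ-is-rim : ∀ {i y} → Adj (hub i) y → ∃ λ j → rim j ≡ y
  hub-neighbourʳ-is-rim {i} {y} iy with vertex-cases y
  ... | inj₁ (i′ , refl) = ⊥-elim (hubs-nonadjacent i i′ iy)
  ... | inj₂ rim-y = rim-y

  hub-neighbourˡ-is-rim : ∀ {i y} → Adj y (hub i) → ∃ λ j → rim j ≡ y
  hub-neighbourˡ-is-rim {i} {y} yi with vertex-cases y
  ... | inj₁ (i′ , refl) = ⊥-elim (hubs-nonadjacent i′ i yi)
  ... | inj₂ rim-y = rim-y

  hub-simplicial : ∀ i → Simplicial (W m 3) (hub i)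
  hub-simplicial i ui iw with hub-neighbourˡ-is-rim ui | hub-neighbourʳ-is-rim iw
  ... | j , refl | j′ , refl with j ≟ j′
  ...   | yes refl = inj₁ refl
  ...   | no j≢j′ = inj₂ (rim-rim-adjacent j≢j′)

  hubs-selected⇒generates : 2 ≤ m → ∀ {P} → (∀ i → hub i ∈ P) → Generates (W m 3) P
  hubs-selected⇒generates (s≤s (s≤s _)) hubs∈P C convex P⊆C x with vertex-cases x
  ... | inj₁ (i , refl) = P⊆C (hubs∈P i)
  ... | inj₂ (j , refl) =
    convex-∋-common-neighbour (W m 3) convex (P⊆C (hubs∈P zero)) (P⊆C (hubs∈P (suc zero)))
      (0≢1+n ∘ hub-injective) (hubs-nonadjacent zero (suc zero))
      (hub-rim-adjacent zero j) (rim-hub-adjacent j (suc zero))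

  freeHubs freeRims : Subset (m + 3) → ℕ
  freeHubs = unselected hub
  freeRims = unselected rim

  position : Subset (m + 3) → ℕ × ℕ
  position P = freeHubs P , freeRims P

  position-∅ : position ∅ ≡ (m , 3)
  position-∅ = cong₂ _,_ (unselected-∅ hub) (unselected-∅ rim)

  freeHub⇒¬generates : ∀ {P} → 0 < freeHubs P → ¬ Generates (W m 3) P
  freeHub⇒¬generates free = let i , i∉P = unselected>0⇒∉ hub free in
    simplicial-∉⇒¬generates (W m 3) (hub-simplicial i) i∉P

  ¬generates⇒freeHub : 2 ≤ m → ∀ {P} → ¬ Generates (W m 3) P → 0 < freeHubs P
  ¬generates⇒freeHub 2≤m {P} ¬generates with freeHubs P in none
  ... | zero = ⊥-elim (¬generates (hubs-selected⇒generates 2≤m (unselected≡0⇒∈ hub none)))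
  ... | suc _ = s≤s z≤n

  select-hub : ∀ {P i} → hub i ∉ P →
               freeHubs P ≡ suc (freeHubs (P ∪ ⁅ hub i ⁆)) × freeRims (P ∪ ⁅ hub i ⁆) ≡ freeRims P
  select-hub {i = i} i∉P = unselected-∪-image hub hub-injective i i∉P
                         , unselected-∪-outside rim (λ _ → ≢-sym hub≢rim)

  select-rim : ∀ {P j} → rim j ∉ P →
               freeRims P ≡ suc (freeRims (P ∪ ⁅ rim j ⁆)) × freeHubs (P ∪ ⁅ rim j ⁆) ≡ freeHubs P
  select-rim {j = j} j∉P = unselected-∪-image rim (↑ʳ-injective m _ _) j j∉P
                         , unselected-∪-outside hub (λ _ → hub≢rim)

  selection-step : ∀ {P v} → v ∉ P → Step (position P) (position (P ∪ ⁅ v ⁆))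
  selection-step {P} {v} v∉P with vertex-cases v
  ... | inj₁ (i , refl) = let hubs , rims = select-hub v∉P in hub-step-by hubs rims
    where
    hub-step-by : ∀ {h r h′ r′} → h ≡ suc h′ → r′ ≡ r → Step (h , r) (h′ , r′)
    hub-step-by refl refl = hub-step
  ... | inj₂ (j , refl) = let rims , hubs = select-rim v∉P in rim-step-by rims hubs
    where
    rim-step-by : ∀ {h r h′ r′} → r ≡ suc r′ → h′ ≡ h → Step (h , r) (h′ , r′)
    rim-step-by refl refl = rim-step

  step-selection : ∀ {P s s′} → Step s s′ → position P ≡ s →
                   Σ Vertex λ v → v ∉ P × position (P ∪ ⁅ v ⁆) ≡ s′
  step-selection {P} hub-step eq with ,-injective eq
  ... | hubs≡ , rims≡ with unselected>0⇒∉ hub (subst (0 <_) (sym hubs≡) (s≤s z≤n))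
  ...   | i , i∉P = let hubs , rims = select-hub i∉P in
    hub i , i∉P , cong₂ _,_ (suc-injective (trans (sym hubs) hubs≡)) (trans rims rims≡)
  step-selection {P} rim-step eq with ,-injective eq
  ... | hubs≡ , rims≡ with unselected>0⇒∉ rim (subst (0 <_) (sym rims≡) (s≤s z≤n))
  ...   | j , j∉P = let rims , hubs = select-rim j∉P in
    rim j , j∉P , cong₂ _,_ (trans hubs hubs≡) (suc-injective (trans (sym rims) rims≡))

  nimAt-position : (Move : Subset (m + 3) → Vertex → Set) (Legal : ℕ × ℕ → ℕ × ℕ → Set)
                   (value : ℕ × ℕ → ℕ) →
                   (∀ {P v} → Move P v → v ∉ P × Legal (position P) (position (P ∪ ⁅ v ⁆))) →
                   (∀ {P v} → v ∉ P → Legal (position P) (position (P ∪ ⁅ v ⁆)) → Move P v) →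
                   (∀ {s k} → k < value s → Σ (ℕ × ℕ) λ s′ → Step s s′ × Legal s s′ × value s′ ≡ k) →
                   (∀ {s s′} → Step s s′ → Legal s s′ → value s′ ≢ value s) →
                   ∀ P → NimAt (W m 3) Move (suc (m + 3)) P (value (position P))
  nimAt-position Move Legal value sound complete reach avoid =
    nimAt-mex (W m 3) Move (value ∘ position) (proj₁ ∘ sound) reach′ avoid′
    where
    reach′ : ∀ {P k} → k < value (position P) →
             Σ Vertex λ v → Move P v × value (position (P ∪ ⁅ v ⁆)) ≡ k
    reach′ k<val with reach k<val
    ... | s′ , step , legal , refl with step-selection step refl
    ...   | v , v∉P , refl = v , complete v∉P legal , refl

    avoid′ : ∀ {P v} → Move P v → value (position (P ∪ ⁅ v ⁆)) ≢ value (position P)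
    avoid′ mv = let v∉P , legal = sound mv in avoid (selection-step v∉P) legal

  dng-nimAt : 2 ≤ m → ∀ P → NimAt (W m 3) (DngMove (W m 3)) (suc (m + 3)) P (dngValue (position P))
  dng-nimAt 2≤m = nimAt-position (DngMove (W m 3)) (λ _ s′ → 0 < proj₁ s′) dngValue
    (λ (v∉P , ¬generates) → v∉P , ¬generates⇒freeHub 2≤m ¬generates)
    (λ v∉P free → v∉P , freeHub⇒¬generates free)
    dngValue-reach dngValue-avoid

  gen-nimAt : 2 ≤ m → ∀ P → NimAt (W m 3) (GenMove (W m 3)) (suc (m + 3)) P (genValue (position P))
  gen-nimAt 2≤m = nimAt-position (GenMove (W m 3)) (λ s _ → 0 < proj₁ s) genValue
    (λ (v∉P , ¬generates) → v∉P , ¬generates⇒freeHub 2≤m ¬generates)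
    (λ v∉P free → v∉P , freeHub⇒¬generates free)
    genValue-reach genValue-avoid

proposition7p26 : (m : ℕ) → 2 ≤ m →
    nimDNG≡ (W m 3) (pty m) × nimGEN≡ (W m 3) (1 ∸ pty m)
proposition7p26 m 2≤m =
    subst (nimDNG≡ (W m 3)) (trans (cong dngValue position-∅) (dngValue-initial (≤-trans (s≤s z≤n) 2≤m)))
      (dng-nimAt 2≤m ∅)
  , subst (nimGEN≡ (W m 3)) (trans (cong genValue position-∅) (genValue-initial 2≤m))
      (gen-nimAt 2≤m ∅)
  where open Wheel m
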